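{- Let $n$ be an odd positive integer such that $p = 2^3 n + 1$ is prime, and let $z$ be a quadratic nonresidue modulo $p$. Define $f_3(x) \in \mathbf{F}_p[x]$ by $$f_3(x) = 2^{ -2} x^{(n+1)/2}\Big[z^{3n}(1 - x^{2n})(1 - x^n z^{2n}) + z^{n}(1 - x^{2n})(1 + x^n z^{2n}) + z^{2n}(1 + x^{2n})(1 - x^n) + (1 + x^{2n})(1 + x^n)\Big].$$ Then $f_3$ is a polynomial representation of the square root modulo $p$: for every quadratic residue $x$ modulo $p$, $\sqrt{x} \equiv \pm f_3(x) \pmod p$, i.e. $f_3(x)^2 \equiv x \pmod p$.
   Context: A quadratic residue modulo $p$ is a nonzero $a$ with $a^{(p-1)/2} \equiv 1 \pmod p$; a quadratic nonresidue is a nonzero $z$ with $z^{(p-1)/2} \equiv -1 \pmod p$. Here $2^{ -2}$ denotes the inverse of $4$ in $\mathbf{F}_p$. -}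

module Defs where

open import Data.Nat as ℕ using (ℕ)
open import Data.Nat.DivMod using (_/_)
open import Data.Integer using (ℤ; +_; _+_; _-_; _*_; _^_)
open import Data.Integer.Divisibility using (_∣_)
open import Relation.Nullary using (¬_)
open import Data.Product using (_×_)

infix 4 _≡_[mod_]
_≡_[mod_] : ℤ → ℤ → ℕ → Set
a ≡ b [mod p ] = (+ p) ∣ (a - b)

QuadResidue : ℕ → ℤ → Set
QuadResidue p a = (¬ (a ≡ + 0 [mod p ])) × (a ^ ((p ℕ.∸ 1) / 2) ≡ + 1 [mod p ])

QuadNonResidue : ℕ → ℤ → Set
QuadNonResidue p z = (¬ (z ≡ + 0 [mod p ])) × (z ^ ((p ℕ.∸ 1) / 2) ≡ Data.Integer.- (+ 1) [mod p ])

-- f₃ with parameters n, z and a chosen representative i of 2^{-2} (inverse of 4 mod p)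
f₃ : ℕ → ℤ → ℤ → ℤ → ℤ
f₃ n z i x =
  i * (x ^ ((n ℕ.+ 1) / 2)) *
    ( z ^ (3 ℕ.* n) * (+ 1 - x ^ (2 ℕ.* n)) * (+ 1 - x ^ n * z ^ (2 ℕ.* n))
    + z ^ n * (+ 1 - x ^ (2 ℕ.* n)) * (+ 1 + x ^ n * z ^ (2 ℕ.* n))
    + z ^ (2 ℕ.* n) * (+ 1 + x ^ (2 ℕ.* n)) * (+ 1 - x ^ n)
    + (+ 1 + x ^ (2 ℕ.* n)) * (+ 1 + x ^ n) )

{-# OPTIONS --safe #-}
-- Put y = xⁿ and w = zⁿ. Euler's criterion with (p − 1)/2 = 4n gives y⁴ ≡ 1 and w⁴ ≡ −1, so
-- w² is a square root of −1 and y is one of ±1, ±w². At these four roots the bracket of f₃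
-- collapses modulo w⁴ + 1 to 4, 4w², 4w³ and 4w respectively, and in every case y · bracket² ≡ 16.
-- As f₃ = 2⁻² · x^((n+1)/2) · bracket and x^(n+1) = x · y, this gives f₃² ≡ 2⁻⁴ · 16 · x = x.
module Submission where

open import Defs
open import Data.Nat using (ℕ)

-- The integer operations are opened only inside this block: the theorem at the end is stated
-- with the natural-number _*_ and _+_.
module _ where
  open import Data.Nat as ℕ using (suc)
  open import Data.Nat.DivMod using (_/_; m*n/n≡m)
  open import Data.Nat.Primality using (Prime; euclidsLemma)
  import Data.Nat.Properties as ℕ
  import Data.Nat.Divisibility as ℕ
  open import Data.Nat.Tactic.RingSolver as ℕ-Solver using ()
  open import Data.Integer.Base using (ℤ; +_; -_; _+_; _-_; _*_; _^_; 0ℤ; 1ℤ; -1ℤ; ∣_∣)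
  open import Data.Integer.Properties using (abs-*; +-identityʳ; *-identityʳ; ^-distribˡ-+-*)
  open import Data.Integer.Divisibility.Signed
    using (_∣_; divides; ∣ᵤ⇒∣; ∣⇒∣ᵤ; ∣m∣n⇒∣m+n; ∣m⇒∣-m; ∣m⇒∣m*n; ∣n⇒∣m*n)
  open import Data.Integer.Tactic.RingSolver using (solve-∀)
  open import Data.Product using (_,_)
  open import Data.Sum as Sum using (_⊎_)
  open import Function using (_∘_)
  open import Relation.Binary.Bundles using (Setoid)
  open import Relation.Binary.PropositionalEquality
    using (_≡_; refl; sym; trans; cong; subst; module ≡-Reasoning)

  ^-double : ∀ a n → a ^ (2 ℕ.* n) ≡ a ^ n * a ^ n
  ^-double a n = trans (^-distribˡ-+-* a n (n ℕ.+ 0)) (cong (λ e → a ^ n * a ^ e) (ℕ.+-identityʳ n))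

  ^-triple : ∀ a n → a ^ (3 ℕ.* n) ≡ a ^ n * (a ^ n * a ^ n)
  ^-triple a n = trans (^-distribˡ-+-* a n (2 ℕ.* n)) (cong (a ^ n *_) (^-double a n))

  ^-quadruple : ∀ a n → a ^ (4 ℕ.* n) ≡ a ^ n * a ^ n * (a ^ n * a ^ n)
  ^-quadruple a n = begin
    a ^ (4 ℕ.* n)                   ≡⟨ cong (a ^_) (ℕ.*-assoc 2 2 n) ⟩
    a ^ (2 ℕ.* (2 ℕ.* n))           ≡⟨ ^-double a (2 ℕ.* n) ⟩
    a ^ (2 ℕ.* n) * a ^ (2 ℕ.* n)   ≡⟨ cong (λ b → b * b) (^-double a n) ⟩
    a ^ n * a ^ n * (a ^ n * a ^ n) ∎
    where open ≡-Reasoning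

  [8n+1∸1]/2≡4n : ∀ n → (8 ℕ.* n ℕ.+ 1 ℕ.∸ 1) / 2 ≡ 4 ℕ.* n
  [8n+1∸1]/2≡4n n = begin
    (8 ℕ.* n ℕ.+ 1 ℕ.∸ 1) / 2 ≡⟨ cong (_/ 2) (ℕ.m+n∸n≡m (8 ℕ.* n) 1) ⟩
    8 ℕ.* n / 2               ≡⟨ cong (_/ 2) (8n≡4n·2 n) ⟩
    4 ℕ.* n ℕ.* 2 / 2         ≡⟨ m*n/n≡m (4 ℕ.* n) 2 ⟩
    4 ℕ.* n                   ∎
    where
    open ≡-Reasoning
    8n≡4n·2 : ∀ n → 8 ℕ.* n ≡ 4 ℕ.* n ℕ.* 2
    8n≡4n·2 = ℕ-Solver.solve-∀

  x^[n+1]/2-squared : ∀ x k → let n = 2 ℕ.* k ℕ.+ 1 in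
    x ^ ((n ℕ.+ 1) / 2) * x ^ ((n ℕ.+ 1) / 2) ≡ x * x ^ n
  x^[n+1]/2-squared x k = begin
    x ^ ((2 ℕ.* k ℕ.+ 1 ℕ.+ 1) / 2) * x ^ ((2 ℕ.* k ℕ.+ 1 ℕ.+ 1) / 2)
      ≡⟨ cong (λ e → x ^ e * x ^ e) (trans (cong (_/ 2) (2k+2≡[k+1]·2 k)) (m*n/n≡m (suc k) 2)) ⟩
    x ^ suc k * x ^ suc k                 ≡⟨ ^-distribˡ-+-* x (suc k) (suc k) ⟨
    x ^ (suc k ℕ.+ suc k)                 ≡⟨ cong (x ^_) ([k+1]+[k+1]≡2k+2 k) ⟩
    x * x ^ (2 ℕ.* k ℕ.+ 1)               ∎
    where
    open ≡-Reasoning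
    2k+2≡[k+1]·2 : ∀ k → 2 ℕ.* k ℕ.+ 1 ℕ.+ 1 ≡ suc k ℕ.* 2
    2k+2≡[k+1]·2 = ℕ-Solver.solve-∀
    [k+1]+[k+1]≡2k+2 : ∀ k → suc k ℕ.+ suc k ≡ suc (2 ℕ.* k ℕ.+ 1)
    [k+1]+[k+1]≡2k+2 = ℕ-Solver.solve-∀

  -- INLINE lets the ring solver see through these definitions.
  f₃-bracket : (y y² w w² w³ : ℤ) → ℤ
  f₃-bracket y y² w w² w³ =
    w³ * (+ 1 - y²) * (+ 1 - y * w²) + w * (+ 1 - y²) * (+ 1 + y * w²)
      + w² * (+ 1 + y²) * (+ 1 - y) + (+ 1 + y²) * (+ 1 + y)
  {-# INLINE f₃-bracket #-}

  bracket : ℤ → ℤ → ℤ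
  bracket y w = f₃-bracket y (y * y) w (w * w) (w * (w * w))
  {-# INLINE bracket #-}

  f₃≡i·X·bracket : ∀ n z i x → f₃ n z i x ≡ i * x ^ ((n ℕ.+ 1) / 2) * bracket (x ^ n) (z ^ n)
  f₃≡i·X·bracket n z i x = cong (i * x ^ ((n ℕ.+ 1) / 2) *_) powers
    where
    powers : f₃-bracket (x ^ n) (x ^ (2 ℕ.* n)) (z ^ n) (z ^ (2 ℕ.* n)) (z ^ (3 ℕ.* n))
           ≡ bracket (x ^ n) (z ^ n)
    powers rewrite ^-double x n | ^-double z n | ^-triple z n = refl

  module Modulo (m : ℕ) where

    -- A record rather than a synonym for _≡_[mod_], so that a and b can be inferred from a proof.
    infix 4 _≈_
    record _≈_ (a b : ℤ) : Set where
      constructor mk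
      field divides-difference : + m ∣ a - b

    ≡mod⇒≈ : ∀ {a b} → a ≡ b [mod m ] → a ≈ b
    ≡mod⇒≈ h = mk (∣ᵤ⇒∣ h)

    ≈⇒≡mod : ∀ {a b} → a ≈ b → a ≡ b [mod m ]
    ≈⇒≡mod (mk h) = ∣⇒∣ᵤ h

    difference-∣⇒≈ : ∀ {a b d} → a - b ≡ d → + m ∣ d → a ≈ b
    difference-∣⇒≈ a-b≡d m∣d = mk (subst (+ m ∣_) (sym a-b≡d) m∣d)

    ≈-refl : ∀ {a} → a ≈ a
    ≈-refl {a} = difference-∣⇒≈ (a-a≡0 a) (divides 0ℤ refl)
      where
      a-a≡0 : ∀ a → a - a ≡ 0ℤ
      a-a≡0 = solve-∀

    ≡⇒≈ : ∀ {a b} → a ≡ b → a ≈ b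
    ≡⇒≈ refl = ≈-refl

    ≈-sym : ∀ {a b} → a ≈ b → b ≈ a
    ≈-sym {a} {b} (mk h) = difference-∣⇒≈ (b-a≡-[a-b] a b) (∣m⇒∣-m h)
      where
      b-a≡-[a-b] : ∀ a b → b - a ≡ - (a - b)
      b-a≡-[a-b] = solve-∀

    ≈-trans : ∀ {a b c} → a ≈ b → b ≈ c → a ≈ c
    ≈-trans {a} {b} {c} (mk h) (mk h′) = difference-∣⇒≈ (telescope a b c) (∣m∣n⇒∣m+n h h′)
      where
      telescope : ∀ a b c → a - c ≡ (a - b) + (b - c)
      telescope = solve-∀

    ≈-setoid : Setoid _ _
    ≈-setoid = record
      { Carrier = ℤ ; _≈_ = _≈_
      ; isEquivalence = record { refl = ≈-refl ; sym = ≈-sym ; trans = ≈-trans } }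

    +-cong : ∀ {a b c d} → a ≈ b → c ≈ d → a + c ≈ b + d
    +-cong {a} {b} {c} {d} (mk h) (mk h′) = difference-∣⇒≈ (regroup a b c d) (∣m∣n⇒∣m+n h h′)
      where
      regroup : ∀ a b c d → (a + c) - (b + d) ≡ (a - b) + (c - d)
      regroup = solve-∀

    -‿cong : ∀ {a b} → a ≈ b → - a ≈ - b
    -‿cong {a} {b} (mk h) = difference-∣⇒≈ (regroup a b) (∣m⇒∣-m h)
      where
      regroup : ∀ a b → - a - - b ≡ - (a - b)
      regroup = solve-∀

    -cong : ∀ {a b c d} → a ≈ b → c ≈ d → a - c ≈ b - d
    -cong a≈b c≈d = +-cong a≈b (-‿cong c≈d)

    *-cong : ∀ {a b c d} → a ≈ b → c ≈ d → a * c ≈ b * d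
    *-cong {a} {b} {c} {d} (mk h) (mk h′) =
      difference-∣⇒≈ (regroup a b c d) (∣m∣n⇒∣m+n (∣m⇒∣m*n c h) (∣n⇒∣m*n b h′))
      where
      regroup : ∀ a b c d → a * c - b * d ≡ (a - b) * c + b * (c - d)
      regroup = solve-∀

    x-y≈0⇒x≈y : ∀ {x y} → x - y ≈ 0ℤ → x ≈ y
    x-y≈0⇒x≈y {x} {y} (mk h) = difference-∣⇒≈ (regroup x y) h
      where
      regroup : ∀ x y → x - y ≡ x - y - 0ℤ
      regroup = solve-∀

    x≡y+u*c⇒x≈y : ∀ {x y u c} → u ≈ 0ℤ → x ≡ y + u * c → x ≈ y
    x≡y+u*c⇒x≈y {y = y} {u} {c} (mk h) refl = difference-∣⇒≈ (regroup y u c) (∣m⇒∣m*n c h)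
      where
      regroup : ∀ y u c → y + u * c - y ≡ (u - 0ℤ) * c
      regroup = solve-∀

    x≈0⇒m∣∣x∣ : ∀ {x} → x ≈ 0ℤ → m ℕ.∣ ∣ x ∣
    x≈0⇒m∣∣x∣ {x} (mk h) = subst (λ d → m ℕ.∣ ∣ d ∣) (+-identityʳ x) (∣⇒∣ᵤ h)

    m∣∣x∣⇒x≈0 : ∀ {x} → m ℕ.∣ ∣ x ∣ → x ≈ 0ℤ
    m∣∣x∣⇒x≈0 {x} h = mk (∣ᵤ⇒∣ (subst (λ d → m ℕ.∣ ∣ d ∣) (sym (+-identityʳ x)) h))

    x*y≈0⇒x≈0⊎y≈0 : Prime m → ∀ {x y} → x * y ≈ 0ℤ → x ≈ 0ℤ ⊎ y ≈ 0ℤ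
    x*y≈0⇒x≈0⊎y≈0 m-prime {x} {y} xy≈0 =
      Sum.map m∣∣x∣⇒x≈0 m∣∣x∣⇒x≈0
        (euclidsLemma ∣ x ∣ ∣ y ∣ m-prime (subst (m ℕ.∣_) (abs-* x y) (x≈0⇒m∣∣x∣ xy≈0)))

    fourth-roots-of-unity : Prime m → ∀ {s y} → s * s ≈ -1ℤ → y * y * (y * y) ≈ 1ℤ →
      y ≈ 1ℤ ⊎ y ≈ -1ℤ ⊎ y ≈ s ⊎ y ≈ - s
    fourth-roots-of-unity m-prime {s} {y} s²≈-1 y⁴≈1 =
      Sum.map x-y≈0⇒x≈y (Sum.map x-y≈0⇒x≈y (Sum.map x-y≈0⇒x≈y x-y≈0⇒x≈y ∘ split) ∘ split)
        (split (≈-trans (x≡y+u*c⇒x≈y (+-cong s²≈-1 ≈-refl) (factorisation y s)) y⁴-1≈0))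
      where
      split : ∀ {a b} → a * b ≈ 0ℤ → a ≈ 0ℤ ⊎ b ≈ 0ℤ
      split = x*y≈0⇒x≈0⊎y≈0 m-prime
      y⁴-1≈0 : y * y * (y * y) - 1ℤ ≈ 0ℤ
      y⁴-1≈0 = -cong y⁴≈1 ≈-refl
      factorisation : ∀ y s → (y - 1ℤ) * ((y - -1ℤ) * ((y - s) * (y - - s)))
                            ≡ (y * y * (y * y) - 1ℤ) + (s * s + 1ℤ) * (1ℤ - y * y)
      factorisation = solve-∀

    f₃-bracket-cong : ∀ {y y′ y² y²′} w w² w³ → y ≈ y′ → y² ≈ y²′ →
      f₃-bracket y y² w w² w³ ≈ f₃-bracket y′ y²′ w w² w³
    f₃-bracket-cong w w² w³ y≈ y²≈ =
      +-cong (+-cong (+-cong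
        (*-cong (*-cong (≈-refl {w³}) (-cong 1≈1 y²≈)) (-cong 1≈1 (*-cong y≈ (≈-refl {w²}))))
        (*-cong (*-cong (≈-refl {w}) (-cong 1≈1 y²≈)) (+-cong 1≈1 (*-cong y≈ (≈-refl {w²})))))
        (*-cong (*-cong (≈-refl {w²}) (+-cong 1≈1 y²≈)) (-cong 1≈1 y≈)))
        (*-cong (+-cong 1≈1 y²≈) (+-cong 1≈1 y≈))
      where
      1≈1 : + 1 ≈ + 1
      1≈1 = ≈-refl

    bracket-at-root : ∀ w {y ζ ζ² c} → y ≈ ζ → ζ * ζ ≈ ζ² →
      f₃-bracket ζ ζ² w (w * w) (w * (w * w)) ≈ c → ζ * c * c ≈ + 16 →
      y * bracket y w * bracket y w ≈ + 16
    bracket-at-root w {y} {ζ} {ζ²} {c} y≈ζ ζζ≈ζ² bracket≈c ζc²≈16 =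
      ≈-trans (*-cong (*-cong y≈ζ bracket≈c′) bracket≈c′) ζc²≈16
      where
      y²≈ζ² : y * y ≈ ζ²
      y²≈ζ² = ≈-trans (*-cong y≈ζ y≈ζ) ζζ≈ζ²
      bracket≈c′ : bracket y w ≈ c
      bracket≈c′ = ≈-trans (f₃-bracket-cong w (w * w) (w * (w * w)) y≈ζ y²≈ζ²) bracket≈c

    y·bracket²≈16 : Prime m → ∀ w y → w * w * (w * w) ≈ -1ℤ → y * y * (y * y) ≈ 1ℤ →
      y * bracket y w * bracket y w ≈ + 16
    y·bracket²≈16 m-prime w y w⁴≈-1 y⁴≈1 =
      Sum.[ root-1 , Sum.[ root-[-1] , Sum.[ root-w² , root-[-w²] ] ] ]
        (fourth-roots-of-unity m-prime w⁴≈-1 y⁴≈1)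
      where
      reduce : ∀ {a b c} → a ≡ b + (w * w * (w * w) + 1ℤ) * c → a ≈ b
      reduce = x≡y+u*c⇒x≈y (+-cong w⁴≈-1 ≈-refl)

      root-1 : y ≈ 1ℤ → y * bracket y w * bracket y w ≈ + 16
      root-1 y≈1 = bracket-at-root w y≈1 ≈-refl (≡⇒≈ (at-1 w)) ≈-refl
        where
        at-1 : ∀ w → f₃-bracket 1ℤ 1ℤ w (w * w) (w * (w * w)) ≡ + 4
        at-1 = solve-∀

      root-[-1] : y ≈ -1ℤ → y * bracket y w * bracket y w ≈ + 16
      root-[-1] y≈-1 =
        bracket-at-root w y≈-1 ≈-refl (≡⇒≈ (at-[-1] w)) (reduce (value w))
        where
        at-[-1] : ∀ w → f₃-bracket -1ℤ 1ℤ w (w * w) (w * (w * w)) ≡ + 4 * (w * w)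
        at-[-1] = solve-∀
        value : ∀ w → -1ℤ * (+ 4 * (w * w)) * (+ 4 * (w * w))
                    ≡ + 16 + (w * w * (w * w) + 1ℤ) * - + 16
        value = solve-∀

      root-w² : y ≈ w * w → y * bracket y w * bracket y w ≈ + 16
      root-w² y≈w² =
        bracket-at-root w y≈w² w⁴≈-1 (reduce (at-w² w)) (reduce (value w))
        where
        at-w² : ∀ w → f₃-bracket (w * w) -1ℤ w (w * w) (w * (w * w))
                    ≡ + 4 * (w * (w * w)) + (w * w * (w * w) + 1ℤ) * (+ 2 * w - + 2 * (w * (w * w)))
        at-w² = solve-∀
        value : ∀ w → w * w * (+ 4 * (w * (w * w))) * (+ 4 * (w * (w * w)))
                    ≡ + 16 + (w * w * (w * w) + 1ℤ) * (+ 16 * (w * w * (w * w) - 1ℤ))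
        value = solve-∀

      root-[-w²] : y ≈ - (w * w) → y * bracket y w * bracket y w ≈ + 16
      root-[-w²] y≈-w² =
        bracket-at-root w y≈-w² (≈-trans (≡⇒≈ (neg-square (w * w))) w⁴≈-1)
          (reduce (at-[-w²] w)) (reduce (value w))
        where
        neg-square : ∀ a → - a * - a ≡ a * a
        neg-square = solve-∀
        at-[-w²] : ∀ w → f₃-bracket (- (w * w)) -1ℤ w (w * w) (w * (w * w))
                       ≡ + 4 * w + (w * w * (w * w) + 1ℤ) * (+ 2 * (w * (w * w)) - + 2 * w)
        at-[-w²] = solve-∀
        value : ∀ w → - (w * w) * (+ 4 * w) * (+ 4 * w) ≡ + 16 + (w * w * (w * w) + 1ℤ) * - + 16
        value = solve-∀

    [i·X·B]²≈x : ∀ i X B {x y} → X * X ≡ x * y → y * B * B ≈ + 16 → + 4 * i ≈ 1ℤ →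
      (i * X * B) * (i * X * B) ≈ x
    [i·X·B]²≈x i X B {x} {y} X²≡xy yB²≈16 4i≈1 = begin
      (i * X * B) * (i * X * B)   ≡⟨ collect i X B ⟩
      i * i * (X * X) * (B * B)   ≡⟨ cong (λ t → i * i * t * (B * B)) X²≡xy ⟩
      i * i * (x * y) * (B * B)   ≡⟨ regroup i x y B ⟩
      x * (i * i) * (y * B * B)   ≈⟨ *-cong (≈-refl {x * (i * i)}) yB²≈16 ⟩
      x * (i * i) * + 16          ≡⟨ sixteen x i ⟩
      x * ((+ 4 * i) * (+ 4 * i)) ≈⟨ *-cong (≈-refl {x}) (*-cong 4i≈1 4i≈1) ⟩
      x * 1ℤ                      ≡⟨ *-identityʳ x ⟩
      x                           ∎
      where
      open import Relation.Binary.Reasoning.Setoid ≈-setoid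
      collect : ∀ i X B → (i * X * B) * (i * X * B) ≡ i * i * (X * X) * (B * B)
      collect = solve-∀
      regroup : ∀ i x y B → i * i * (x * y) * (B * B) ≡ x * (i * i) * (y * B * B)
      regroup = solve-∀
      sixteen : ∀ x i → x * (i * i) * + 16 ≡ x * ((+ 4 * i) * (+ 4 * i))
      sixteen = solve-∀

    residue⇒[xⁿ]⁴≈1 : ∀ n {x} → (m ℕ.∸ 1) / 2 ≡ 4 ℕ.* n → QuadResidue m x →
      x ^ n * x ^ n * (x ^ n * x ^ n) ≈ 1ℤ
    residue⇒[xⁿ]⁴≈1 n {x} half≡4n (_ , x^half≡1) =
      ≈-trans (≡⇒≈ (sym (trans (cong (x ^_) half≡4n) (^-quadruple x n)))) (≡mod⇒≈ x^half≡1)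

    nonresidue⇒[zⁿ]⁴≈-1 : ∀ n {z} → (m ℕ.∸ 1) / 2 ≡ 4 ℕ.* n → QuadNonResidue m z →
      z ^ n * z ^ n * (z ^ n * z ^ n) ≈ -1ℤ
    nonresidue⇒[zⁿ]⁴≈-1 n {z} half≡4n (_ , z^half≡-1) =
      ≈-trans (≡⇒≈ (sym (trans (cong (z ^_) half≡4n) (^-quadruple z n)))) (≡mod⇒≈ z^half≡-1)

open import Data.Nat using (_*_; _+_)
open import Data.Nat.Primality using (Prime)
open import Relation.Binary.PropositionalEquality using (_≡_; refl; sym; subst)
open import Data.Integer using (ℤ; +_; -1ℤ; _^_) renaming (_*_ to _*ℤ_)
open import Data.Nat.DivMod using (_/_)

mainTheorem3 : (n k : ℕ) → n ≡ 2 * k + 1 → Prime (8 * n + 1) →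
    (z : ℤ) → QuadNonResidue (8 * n + 1) z →
    (i : ℤ) → (+ 4) *ℤ i ≡ + 1 [mod (8 * n + 1) ] →
    (x : ℤ) → QuadResidue (8 * n + 1) x →
    (f₃ n z i x) *ℤ (f₃ n z i x) ≡ x [mod (8 * n + 1) ]
mainTheorem3 .(2 * k + 1) k refl p-prime z z-nonresidue i 4i≡1 x x-residue =
  ≈⇒≡mod (subst (λ f → f *ℤ f ≈ x) (sym (f₃≡i·X·bracket n z i x))
    ([i·X·B]²≈x i (x ^ ((n + 1) / 2)) (bracket y w) (x^[n+1]/2-squared x k)
      (y·bracket²≈16 p-prime w y w⁴≈-1 y⁴≈1) (≡mod⇒≈ 4i≡1)))
  where
  n : ℕ
  n = 2 * k + 1
  open Modulo (8 * n + 1)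
  y w : ℤ
  y = x ^ n
  w = z ^ n
  y⁴≈1 : y *ℤ y *ℤ (y *ℤ y) ≈ + 1
  y⁴≈1 = residue⇒[xⁿ]⁴≈1 n ([8n+1∸1]/2≡4n n) x-residue
  w⁴≈-1 : w *ℤ w *ℤ (w *ℤ w) ≈ -1ℤ
  w⁴≈-1 = nonresidue⇒[zⁿ]⁴≈-1 n ([8n+1∸1]/2≡4n n) z-nonresidue
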